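{- Let $n>2$ be odd and let $T$ be a perfect $n$-ary tree in which every leaf vertex is at depth $2$. Then $\sigma^{ - }(T)=n>\left\lceil\frac{\Delta}{2}\right\rceil$, where $\Delta$ is the maximum degree of $T$.
   Context: For a connected simple graph $G$ of order $p$, a parity labelling is a bijection $f:V(G)\to\{1,\ldots,p\}$; an edge $uv$ is negative if $f(u),f(v)$ have opposite parity. The rna number $\sigma^{ - }(G)$ is the minimum over all such $f$ of the number of negative edges. For a rooted tree with root $u_0$, the depth of a vertex $u$ is $d(u,u_0)$. A perfect $k$-ary tree is a rooted tree in which all leaf vertices are at the same depth and all internal (non-leaf) vertices, including the root, have degree $k$. -}

module Defs where

open import Data.Nat using (ℕ; zero; suc; _+_; _*_; _∸_; _%_; _≤_; _⊔_)
open import Data.Nat.Properties using (_≟_)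
open import Data.Fin using (Fin; toℕ)
open import Data.Fin.Properties using () renaming (_≟_ to _≟F_)
open import Data.Unit using (⊤; tt)
open import Data.Unit.Properties using () renaming (_≟_ to _≟⊤_)
open import Data.Sum using (_⊎_; inj₁; inj₂)
import Data.Sum.Properties as SumP
open import Data.Product using (_×_; _,_; proj₁; proj₂; ∃)
import Data.Product.Properties as ProdP
open import Data.List using (List; []; _∷_; _++_; map; concatMap; filter; length; foldr; allFin)
open import Function.Bundles using (_⤖_; Bijection)
open import Relation.Binary.Definitions using (DecidableEquality)
open import Relation.Binary.PropositionalEquality using (_≡_)
open import Relation.Nullary using (¬?; _⊎-dec_)

-- A finite simple graph, presented by: a vertex type V, its order p,
-- an enumeration of the vertices, decidable equality on V, and the list
-- of its edges (each edge listed exactly once, as an unordered pair).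
record Graph : Set₁ where
  field
    V        : Set
    order    : ℕ
    vertices : List V
    _≟V_     : DecidableEquality V
    edges    : List (V × V)

module _ (G : Graph) where
  open Graph G

  -- A parity labelling: a bijection V → {1,…,p}; we represent the label
  -- set {1,…,p} by Fin p, with i : Fin p standing for the label toℕ i + 1.
  Labelling : Set
  Labelling = V ⤖ Fin order

  label : Labelling → V → ℕ
  label f v = suc (toℕ (Bijection.to f v))

  negEdges : Labelling → ℕ
  negEdges f =
    length (filter (λ e → ¬? (label f (proj₁ e) % 2 ≟ label f (proj₂ e) % 2)) edges)

  IsRnaNumber : ℕ → Set
  IsRnaNumber k = (∃ λ (f : Labelling) → negEdges f ≡ k)
                × (∀ (f : Labelling) → k ≤ negEdges f)

  degree : V → ℕ
  degree v = length (filter (λ e → (proj₁ e ≟V v) ⊎-dec (proj₂ e ≟V v)) edges)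

  maxDegree : ℕ
  maxDegree = foldr _⊔_ 0 (map degree vertices)

-- The perfect n-ary tree with all leaves at depth 2:
-- root (degree n) with n children; every child is internal, hence has
-- degree n, i.e. n ∸ 1 children of its own, which are leaves.
TVertex : ℕ → Set
TVertex n = ⊤ ⊎ (Fin n ⊎ (Fin n × Fin (n ∸ 1)))

root : ∀ {n} → TVertex n
root = inj₁ tt

child : ∀ {n} → Fin n → TVertex n
child i = inj₂ (inj₁ i)

grandchild : ∀ {n} → Fin n → Fin (n ∸ 1) → TVertex n
grandchild i j = inj₂ (inj₂ (i , j))

_≟T_ : ∀ {n} → DecidableEquality (TVertex n)
_≟T_ = SumP.≡-dec _≟⊤_ (SumP.≡-dec _≟F_ (ProdP.≡-dec _≟F_ _≟F_))

perfectTree2 : ℕ → Graph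
perfectTree2 n = record
  { V        = TVertex n
  ; order    = 1 + n + n * (n ∸ 1)
  ; vertices = root ∷ map child (allFin n)
               ++ concatMap (λ i → map (grandchild i) (allFin (n ∸ 1))) (allFin n)
  ; _≟V_     = _≟T_
  ; edges    = map (λ i → root , child i) (allFin n)
               ++ concatMap (λ i → map (λ j → child i , grandchild i j) (allFin (n ∸ 1))) (allFin n)
  }

-- Write n = 2t + 1. Let r be the parity of the root's label and call a vertex off if its parity
-- differs from r; exactly half, q = 2t² + 2t + 1, of the p = 2q labels are off. In the branch
-- below child i, with x_i off vertices, the number cost_i of negative edges is x_i if child i is
-- not off and 2t + 2 − x_i if it is. Hence x_i ≤ cost_i + 2t·d_i and (2t + 2)·d_i ≤ cost_i + x_i,
-- where d_i indicates that child i is off. Summing, with a off children and C negative edges,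
-- q ≤ C + 2t·a and (2t + 2)·a ≤ C + q: if a ≤ t the first inequality, and otherwise the second,
-- gives C ≥ 2t + 1 = n. Equality is attained by splitting the vertices into two classes of size q
-- that differ only across t + 1 root edges and t edges below a single child, odd labels going to
-- one class and even labels to the other. All degrees are at most n, so ⌈Δ/2⌉ ≤ t + 1 < n.
module Submission where

open import Defs

open import Data.Bool using (true; false; if_then_else_)
open import Data.Fin using (Fin; zero; suc; toℕ; splitAt; join; combine; _↑ˡ_; _↑ʳ_)
open import Data.Fin.Properties
  using (join-splitAt; splitAt-↑ˡ; splitAt-↑ʳ; toℕ-combine; 1↔⊤; +↔⊎; *↔×)
  renaming (_≟_ to _≟F_)
open import Data.List using (List; _++_; map; concatMap; filter; length; allFin; tabulate)
open import Data.List.Properties using (length-++; filter-++; map-tabulate; foldr-preservesᵇ)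
open import Data.List.Relation.Unary.All using (universal)
open import Data.List.Relation.Unary.All.Properties using (map⁺)
open import Data.Nat using (ℕ; zero; suc; _+_; _*_; _∸_; _≤_; _<_; _%_; _/_; ⌈_/2⌉; z≤n; s≤s)
open import Data.Nat.DivMod using (m%n<n; [m+n]%n≡m%n; [m+kn]%n≡m%n; m≡m%n+[m/n]*n)
open import Data.Nat.Properties
open import Algebra.Properties.Semiring.Sum +-*-semiring
  using (sum; sum-syntax; sum-cong-≗; ∑-distrib-+; *-distribˡ-sum; sum-permute; sum-replicate-zero)
open import Data.Nat.Solver using (module +-*-Solver)
open +-*-Solver using (solve; _:+_; _:*_; _:=_; con)
open import Data.Product using (Σ; ∃-syntax; _×_; _,_; proj₁; proj₂)
open import Data.Product.Function.NonDependent.Propositional using (_×-↔_)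
open import Data.Sum using (_⊎_; inj₁; inj₂; map₁)
open import Data.Sum.Function.Propositional using (_⊎-↔_)
open import Data.Unit using (tt)
open import Function using (_∘_; id; _↔_; Inverse; Bijection; mk↔ₛ′)
open import Function.Properties.Bijection using (⤖⇒↔)
open import Function.Properties.Inverse using (↔-refl; ↔-sym; ↔-trans; ↔⇒⤖)
open import Relation.Binary.PropositionalEquality
open import Relation.Nullary using (Dec; yes; no; does; ¬_; ¬?; _⊎-dec_; contradiction)
open import Relation.Nullary.Decidable using (dec-true; dec-false)
open import Relation.Unary using (Pred; Decidable)

-- Uses only `does`, so it computes wherever `filter` does, including through `map′`.
𝟙[_] : ∀ {p} {P : Set p} → Dec P → ℕ
𝟙[ P? ] = if does P? then 1 else 0

𝟙≤1 : ∀ {p} {P : Set p} (P? : Dec P) → 𝟙[ P? ] ≤ 1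
𝟙≤1 (yes _) = s≤s z≤n
𝟙≤1 (no _)  = z≤n

𝟙-mono : ∀ {p q} {P : Set p} {Q : Set q} → (P → Q) →
         (P? : Dec P) (Q? : Dec Q) → 𝟙[ P? ] ≤ 𝟙[ Q? ]
𝟙-mono P⇒Q (yes p) (yes _) = ≤-refl
𝟙-mono P⇒Q (yes p) (no ¬q) with () ← ¬q (P⇒Q p)
𝟙-mono P⇒Q (no _)  _       = z≤n

𝟙-yes : ∀ {p} {P : Set p} (P? : Dec P) → P → 𝟙[ P? ] ≡ 1
𝟙-yes P? p = cong (if_then 1 else 0) (dec-true P? p)

𝟙-no : ∀ {p} {P : Set p} (P? : Dec P) → ¬ P → 𝟙[ P? ] ≡ 0
𝟙-no P? ¬p = cong (if_then 1 else 0) (dec-false P? ¬p)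

sum-const : ∀ m c → ∑[ i < m ] c ≡ m * c
sum-const zero    c = refl
sum-const (suc m) c = cong (c +_) (sum-const m c)

sum-ones : ∀ m → ∑[ i < m ] 1 ≡ m
sum-ones m = trans (sum-const m 1) (*-identityʳ m)

sum-mono : ∀ {m} {f g : Fin m → ℕ} → (∀ i → f i ≤ g i) → sum f ≤ sum g
sum-mono {zero}  f≤g = z≤n
sum-mono {suc m} f≤g = +-mono-≤ (f≤g zero) (sum-mono (f≤g ∘ suc))

sum-splitAt : ∀ m {n} (g : Fin m ⊎ Fin n → ℕ) →
              ∑[ k < m + n ] g (splitAt m k) ≡ ∑[ i < m ] g (inj₁ i) + ∑[ j < n ] g (inj₂ j)
sum-splitAt zero    g = refl
sum-splitAt (suc m) g = trans (cong (g (inj₁ zero) +_) (sum-splitAt m (g ∘ map₁ suc)))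
                              (sym (+-assoc (g (inj₁ zero)) _ _))

sum-↑ : ∀ m {n} (g : Fin (m + n) → ℕ) →
        sum g ≡ ∑[ i < m ] g (i ↑ˡ n) + ∑[ j < n ] g (m ↑ʳ j)
sum-↑ m {n} g = trans (sum-cong-≗ (cong g ∘ sym ∘ join-splitAt m n)) (sum-splitAt m (g ∘ join m n))

sum-combine : ∀ m {n} (g : Fin (m * n) → ℕ) → sum g ≡ ∑[ i < m ] ∑[ j < n ] g (combine i j)
sum-combine zero    g = refl
sum-combine (suc m) {n} g =
  trans (sum-↑ n g) (cong (∑[ j < n ] g (j ↑ˡ m * n) +_) (sum-combine m (g ∘ (n ↑ʳ_))))

sum-periodic₂ : ∀ q (g : ℕ → ℕ) → (∀ x → g (2 + x) ≡ g x) →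
                ∑[ k < q * 2 ] g (toℕ k) ≡ q * (g 0 + g 1)
sum-periodic₂ zero    g periodic = refl
sum-periodic₂ (suc q) g periodic = begin
    g 0 + (g 1 + ∑[ k < q * 2 ] g (2 + toℕ k))
  ≡⟨ cong (λ x → g 0 + (g 1 + x))
          (trans (sum-cong-≗ {q * 2} (periodic ∘ toℕ)) (sum-periodic₂ q g periodic)) ⟩
    g 0 + (g 1 + q * (g 0 + g 1))
  ≡⟨ +-assoc (g 0) (g 1) _ ⟨
    g 0 + g 1 + q * (g 0 + g 1) ∎
  where open ≡-Reasoning

sum-𝟙-≟ : ∀ {m} (i₀ : Fin m) → ∑[ i < m ] 𝟙[ i ≟F i₀ ] ≡ 1
sum-𝟙-≟ {suc m} zero     = cong suc (sum-replicate-zero m)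
sum-𝟙-≟ {suc m} (suc i₀) = sum-𝟙-≟ i₀

module _ {a p} {A : Set a} {P : Pred A p} (P? : Decidable P) where

  length-filter-++ : ∀ xs ys →
    length (filter P? (xs ++ ys)) ≡ length (filter P? xs) + length (filter P? ys)
  length-filter-++ xs ys = trans (cong length (filter-++ P? xs ys)) (length-++ (filter P? xs))

  length-filter-tabulate : ∀ {n} (f : Fin n → A) →
    length (filter P? (tabulate f)) ≡ ∑[ i < n ] 𝟙[ P? (f i) ]
  length-filter-tabulate {zero}  f = refl
  length-filter-tabulate {suc n} f with does (P? (f zero))
  ... | true  = cong suc (length-filter-tabulate (f ∘ suc))
  ... | false = length-filter-tabulate (f ∘ suc)

  length-filter-map-allFin : ∀ {n} (f : Fin n → A) →
    length (filter P? (map f (allFin n))) ≡ ∑[ i < n ] 𝟙[ P? (f i) ]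
  length-filter-map-allFin f =
    trans (cong (length ∘ filter P?) (map-tabulate id f)) (length-filter-tabulate f)

  length-filter-concatMap-tabulate : ∀ {b} {B : Set b} {n} (f : B → List A) (h : Fin n → B) →
    length (filter P? (concatMap f (tabulate h))) ≡ ∑[ i < n ] length (filter P? (f (h i)))
  length-filter-concatMap-tabulate {n = zero}  f h = refl
  length-filter-concatMap-tabulate {n = suc n} f h =
    trans (length-filter-++ (f (h zero)) _)
          (cong (length (filter P? (f (h zero))) +_) (length-filter-concatMap-tabulate f (h ∘ suc)))

differ : ℕ → ℕ → ℕ
differ x y = 𝟙[ ¬? (x ≟ y) ]

differ-≡ : ∀ {x y} → x ≡ y → differ x y ≡ 0
differ-≡ {x} {y} x≡y = 𝟙-no (¬? (x ≟ y)) (λ x≢y → x≢y x≡y)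

differ-≢ : ∀ {x y} → x ≢ y → differ x y ≡ 1
differ-≢ {x} {y} = 𝟙-yes (¬? (x ≟ y))

differ≤1 : ∀ x y → differ x y ≤ 1
differ≤1 x y = 𝟙≤1 (¬? (x ≟ y))

differ-complement : ∀ {x y z} → x < 2 → y < 2 → z < 2 → x ≢ y → differ x z + differ y z ≡ 1
differ-complement {0} {0} _ _ _ x≢y = contradiction refl x≢y
differ-complement {1} {1} _ _ _ x≢y = contradiction refl x≢y
differ-complement {0} {1} {0} _ _ _ _ = refl
differ-complement {0} {1} {1} _ _ _ _ = refl
differ-complement {1} {0} {0} _ _ _ _ = refl
differ-complement {1} {0} {1} _ _ _ _ = refl
differ-complement {suc (suc _)} (s≤s (s≤s ())) _ _ _
differ-complement {y = suc (suc _)} _ (s≤s (s≤s ())) _ _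
differ-complement {0} {1} {suc (suc _)} _ _ (s≤s (s≤s ())) _
differ-complement {1} {0} {suc (suc _)} _ _ (s≤s (s≤s ())) _

sum-differ-parity : ∀ q {m} → m ≡ q * 2 → ∀ {r} → r < 2 →
                    ∑[ k < m ] differ r (suc (toℕ k) % 2) ≡ q
sum-differ-parity q refl {r} r<2 = begin
    ∑[ k < q * 2 ] g (toℕ k)   ≡⟨ sum-periodic₂ q g periodic ⟩
    q * (g 0 + g 1)           ≡⟨ cong (q *_) (bothParities r<2) ⟩
    q * 1                     ≡⟨ *-identityʳ q ⟩
    q                         ∎
  where
  open ≡-Reasoning
  g : ℕ → ℕ
  g x = differ r (suc x % 2)
  periodic : ∀ x → g (2 + x) ≡ g x
  periodic x = cong (differ r) (trans (cong (_% 2) (+-comm 2 (suc x))) ([m+n]%n≡m%n (suc x) 2))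
  bothParities : ∀ {r} → r < 2 → differ r 1 + differ r 0 ≡ 1
  bothParities {0} _ = refl
  bothParities {1} _ = refl
  bothParities {suc (suc _)} (s≤s (s≤s ()))

branchSum : ∀ {n} → (TVertex n → ℕ) → Fin n → ℕ
branchSum {n} h i = h (child i) + ∑[ j < n ∸ 1 ] h (grandchild i j)

vertexSum : ∀ {n} → (TVertex n → ℕ) → ℕ
vertexSum {n} h = h root + ∑[ i < n ] branchSum h i

branchCost : ∀ {n} → (TVertex n → ℕ) → Fin n → ℕ
branchCost {n} c i =
  differ (c root) (c (child i)) + ∑[ j < n ∸ 1 ] differ (c (child i)) (c (grandchild i j))

parity : ∀ {n} → Labelling (perfectTree2 n) → TVertex n → ℕ
parity {n} f v = label (perfectTree2 n) f v % 2

offRoot : ∀ {n} → (TVertex n → ℕ) → TVertex n → ℕ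
offRoot c v = differ (c root) (c v)

branchCost-cong : ∀ {n} {c c′ : TVertex n → ℕ} → (∀ v → c v ≡ c′ v) →
                  ∀ i → branchCost c i ≡ branchCost c′ i
branchCost-cong c≗c′ i = cong₂ _+_ (cong₂ differ (c≗c′ root) (c≗c′ (child i)))
  (sum-cong-≗ λ j → cong₂ differ (c≗c′ (child i)) (c≗c′ (grandchild i j)))

module _ {n : ℕ} where

  length-filter-edges : ∀ {p} {P : Pred (TVertex n × TVertex n) p} (P? : Decidable P) →
    length (filter P? (Graph.edges (perfectTree2 n))) ≡
    ∑[ i < n ] (𝟙[ P? (root , child i) ] + ∑[ j < n ∸ 1 ] 𝟙[ P? (child i , grandchild i j) ])
  length-filter-edges P? = begin
      length (filter P? (rootEdges ++ concatMap childEdges (allFin n)))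
    ≡⟨ length-filter-++ P? rootEdges _ ⟩
      length (filter P? rootEdges) + length (filter P? (concatMap childEdges (allFin n)))
    ≡⟨ cong₂ _+_ (length-filter-map-allFin P? (λ i → root , child i))
                 (trans (length-filter-concatMap-tabulate P? childEdges id)
                        (sum-cong-≗ λ i → length-filter-map-allFin P? (λ j → child i , grandchild i j))) ⟩
      ∑[ i < n ] 𝟙[ P? (root , child i) ]
        + ∑[ i < n ] ∑[ j < n ∸ 1 ] 𝟙[ P? (child i , grandchild i j) ]
    ≡⟨ ∑-distrib-+ {n} _ _ ⟨
      ∑[ i < n ] (𝟙[ P? (root , child i) ] + ∑[ j < n ∸ 1 ] 𝟙[ P? (child i , grandchild i j) ]) ∎
    where
    open ≡-Reasoning
    rootEdges : List (TVertex n × TVertex n)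
    rootEdges = map (λ i → root , child i) (allFin n)
    childEdges : Fin n → List (TVertex n × TVertex n)
    childEdges i = map (λ j → child i , grandchild i j) (allFin (n ∸ 1))

  negEdges≡∑branchCost : ∀ f → negEdges (perfectTree2 n) f ≡ ∑[ i < n ] branchCost (parity f) i
  negEdges≡∑branchCost f = length-filter-edges _

  vertexNumbering : Fin (Graph.order (perfectTree2 n)) ↔ TVertex n
  vertexNumbering = ↔-trans (+↔⊎ {1}) (1↔⊤ ⊎-↔ ↔-trans (+↔⊎ {n}) (↔-refl ⊎-↔ *↔×))

  sum≡vertexSum : ∀ g → sum g ≡ vertexSum (g ∘ Inverse.from vertexNumbering)
  sum≡vertexSum g = begin
      g zero + sum (g ∘ suc)
    ≡⟨ cong (g zero +_) (sum-↑ n (g ∘ suc)) ⟩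
      g zero + (∑[ i < n ] atChild i + sum (λ k → g (suc (n ↑ʳ k))))
    ≡⟨ cong (λ x → g zero + (∑[ i < n ] atChild i + x)) (sum-combine n (g ∘ suc ∘ (n ↑ʳ_))) ⟩
      g zero + (∑[ i < n ] atChild i + ∑[ i < n ] ∑[ j < n ∸ 1 ] g (suc (n ↑ʳ combine i j)))
    ≡⟨ cong (g zero +_) (∑-distrib-+ {n} _ _) ⟨
      vertexSum (g ∘ Inverse.from vertexNumbering) ∎
    where
    open ≡-Reasoning
    atChild : Fin n → ℕ
    atChild i = g (suc (i ↑ˡ n * (n ∸ 1)))

  vertexSum-cong : ∀ {g h : TVertex n → ℕ} → (∀ v → g v ≡ h v) → vertexSum g ≡ vertexSum h
  vertexSum-cong g≗h = cong₂ _+_ (g≗h root)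
    (sum-cong-≗ λ i → cong₂ _+_ (g≗h (child i)) (sum-cong-≗ λ j → g≗h (grandchild i j)))

  vertexSum-labels : ∀ (f : Labelling (perfectTree2 n)) h → vertexSum (h ∘ Bijection.to f) ≡ sum h
  vertexSum-labels f h = sym (begin
      sum h
    ≡⟨ sum-permute h π ⟩
      sum (h ∘ Inverse.to π)
    ≡⟨ sum≡vertexSum (h ∘ Inverse.to π) ⟩
      vertexSum (h ∘ Inverse.to π ∘ Inverse.from vertexNumbering)
    ≡⟨ vertexSum-cong (λ v → cong (h ∘ Bijection.to f)
                                   (Inverse.inverseˡ vertexNumbering {v} refl)) ⟩
      vertexSum (h ∘ Bijection.to f) ∎)
    where
    open ≡-Reasoning
    π : Fin (Graph.order (perfectTree2 n)) ↔ Fin (Graph.order (perfectTree2 n))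
    π = ↔-trans vertexNumbering (⤖⇒↔ f)

module _ {n : ℕ} (c : TVertex n → ℕ) (c<2 : ∀ v → c v < 2) (i : Fin n) where
  private
    N = n ∸ 1
    r = c root
    y = c (child i)
    z : Fin N → ℕ
    z j = c (grandchild i j)
    A = ∑[ j < N ] differ y (z j)
    B = ∑[ j < N ] differ r (z j)

  branchSum-offRoot≤ : branchSum (offRoot c) i ≤ branchCost c i + N * offRoot c (child i)
  branchSum-offRoot≤ with r ≟ y
  ... | yes r≡y = begin
      differ r y + B
    ≡⟨ cong (λ x → differ r y + ∑[ j < N ] differ x (z j)) r≡y ⟩
      branchCost c i
    ≤⟨ m≤m+n _ _ ⟩
      branchCost c i + N * offRoot c (child i) ∎
    where open ≤-Reasoning
  ... | no r≢y = begin
      differ r y + B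
    ≤⟨ +-monoʳ-≤ (differ r y) (sum-mono {N} {g = λ _ → 1} (differ≤1 r ∘ z)) ⟩
      differ r y + ∑[ j < N ] 1
    ≡⟨ cong₂ _+_ (differ-≢ r≢y) (sum-const N 1) ⟩
      1 + N * 1
    ≤⟨ +-monoˡ-≤ (N * 1) 1≤branchCost ⟩
      branchCost c i + N * 1
    ≡⟨ cong (λ d → branchCost c i + N * d) (differ-≢ r≢y) ⟨
      branchCost c i + N * offRoot c (child i) ∎
    where
    open ≤-Reasoning
    1≤branchCost : 1 ≤ branchCost c i
    1≤branchCost = ≤-trans (≤-reflexive (sym (differ-≢ r≢y))) (m≤m+n _ _)

  offRoot≤branchCost+branchSum : (2 + N) * offRoot c (child i) ≤ branchCost c i + branchSum (offRoot c) i
  offRoot≤branchCost+branchSum with r ≟ y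
  ... | yes r≡y = ≤-trans (≤-reflexive (trans (cong ((2 + N) *_) (differ-≡ r≡y)) (*-zeroʳ (2 + N)))) z≤n
  ... | no r≢y = ≤-reflexive (begin
      (2 + N) * offRoot c (child i)                     ≡⟨ cong ((2 + N) *_) (differ-≢ r≢y) ⟩
      (2 + N) * 1                                       ≡⟨ *-identityʳ (2 + N) ⟩
      2 + N                                             ≡⟨ cong (2 +_) (sum-ones N) ⟨
      2 + ∑[ j < N ] 1                                  ≡⟨ cong (2 +_) (sum-cong-≗ {N} complement) ⟨
      2 + ∑[ j < N ] (differ y (z j) + differ r (z j))  ≡⟨ cong (2 +_) (∑-distrib-+ {N} _ _) ⟩
      2 + (A + B)                                       ≡⟨ cong suc (+-suc A B) ⟨
      (1 + A) + (1 + B)                                 ≡⟨ cong₂ (λ d e → (d + A) + (e + B)) d≡1 d≡1 ⟨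
      branchCost c i + branchSum (offRoot c) i          ∎)
    where
    open ≡-Reasoning
    d≡1 : differ r y ≡ 1
    d≡1 = differ-≢ r≢y
    complement : ∀ j → differ y (z j) + differ r (z j) ≡ 1
    complement j = differ-complement (c<2 (child i)) (c<2 root) (c<2 (grandchild i j)) (r≢y ∘ sym)

halfOrder : ℕ → ℕ
halfOrder t = suc t + (t + t * (t + t))

order≡halfOrder*2 : ∀ t → Graph.order (perfectTree2 (suc (t + t))) ≡ halfOrder t * 2
order≡halfOrder*2 = solve 1 (λ t → con 2 :+ (t :+ t) :+ (con 1 :+ (t :+ t)) :* (t :+ t)
                                  := (con 1 :+ t :+ (t :+ t :* (t :+ t))) :* con 2) refl

lowerBound-arith : ∀ t C a → halfOrder t ≤ C + (t + t) * a → (2 + (t + t)) * a ≤ C + halfOrder t →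
                   suc (t + t) ≤ C
lowerBound-arith t C a offVertices≤ offChildren≤ with a ≤? t
... | yes a≤t = +-cancelʳ-≤ ((t + t) * t) (suc (t + t)) C (begin
    suc (t + t) + (t + t) * t   ≡⟨ solve 1 (λ t → con 1 :+ (t :+ t) :+ (t :+ t) :* t
                                            := con 1 :+ t :+ (t :+ t :* (t :+ t))) refl t ⟩
    halfOrder t                 ≤⟨ offVertices≤ ⟩
    C + (t + t) * a             ≤⟨ +-monoʳ-≤ C (*-monoʳ-≤ (t + t) a≤t) ⟩
    C + (t + t) * t             ∎)
  where open ≤-Reasoning
... | no a≰t = +-cancelʳ-≤ (halfOrder t) (suc (t + t)) C (begin
    suc (t + t) + halfOrder t   ≡⟨ solve 1 (λ t → con 1 :+ (t :+ t) :+ (con 1 :+ t :+ (t :+ t :* (t :+ t)))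
                                            := (con 2 :+ (t :+ t)) :* (con 1 :+ t)) refl t ⟩
    (2 + (t + t)) * suc t       ≤⟨ *-monoʳ-≤ (2 + (t + t)) (≰⇒> a≰t) ⟩
    (2 + (t + t)) * a           ≤⟨ offChildren≤ ⟩
    C + halfOrder t             ∎)
  where open ≤-Reasoning

n≤negEdges : ∀ t (f : Labelling (perfectTree2 (suc (t + t)))) →
             suc (t + t) ≤ negEdges (perfectTree2 (suc (t + t))) f
n≤negEdges t f =
  subst (suc (t + t) ≤_) (sym (negEdges≡∑branchCost f))
        (lowerBound-arith t C a offVertices≤ offChildren≤)
  where
  n N : ℕ
  n = suc (t + t)
  N = t + t
  c : TVertex n → ℕ
  c = parity f
  c<2 : ∀ v → c v < 2
  c<2 v = m%n<n (label (perfectTree2 n) f v) 2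
  C a : ℕ
  C = ∑[ i < n ] branchCost c i
  a = ∑[ i < n ] offRoot c (child i)
  offVertices : ∑[ i < n ] branchSum (offRoot c) i ≡ halfOrder t
  offVertices = begin
      ∑[ i < n ] branchSum (offRoot c) i
    ≡⟨ cong (_+ ∑[ i < n ] branchSum (offRoot c) i) (differ-≡ {c root} refl) ⟨
      vertexSum (offRoot c)
    ≡⟨ vertexSum-labels f (λ k → differ (c root) (suc (toℕ k) % 2)) ⟩
      ∑[ k < Graph.order (perfectTree2 n) ] differ (c root) (suc (toℕ k) % 2)
    ≡⟨ sum-differ-parity (halfOrder t) (order≡halfOrder*2 t) (c<2 root) ⟩
      halfOrder t ∎
    where open ≡-Reasoning
  offVertices≤ : halfOrder t ≤ C + N * a
  offVertices≤ = begin
      halfOrder t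
    ≡⟨ offVertices ⟨
      ∑[ i < n ] branchSum (offRoot c) i
    ≤⟨ sum-mono (branchSum-offRoot≤ c c<2) ⟩
      ∑[ i < n ] (branchCost c i + N * offRoot c (child i))
    ≡⟨ ∑-distrib-+ (branchCost c) ((N *_) ∘ offRoot c ∘ child) ⟩
      C + ∑[ i < n ] (N * offRoot c (child i))
    ≡⟨ cong (C +_) (*-distribˡ-sum N (offRoot c ∘ child)) ⟨
      C + N * a ∎
    where open ≤-Reasoning
  offChildren≤ : (2 + N) * a ≤ C + halfOrder t
  offChildren≤ = begin
      (2 + N) * a
    ≡⟨ *-distribˡ-sum (2 + N) (offRoot c ∘ child) ⟩
      ∑[ i < n ] ((2 + N) * offRoot c (child i))
    ≤⟨ sum-mono (offRoot≤branchCost+branchSum c c<2) ⟩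
      ∑[ i < n ] (branchCost c i + branchSum (offRoot c) i)
    ≡⟨ ∑-distrib-+ (branchCost c) (branchSum (offRoot c)) ⟩
      C + ∑[ i < n ] branchSum (offRoot c) i
    ≡⟨ cong (C +_) offVertices ⟩
      C + halfOrder t ∎
    where open ≤-Reasoning

classParity : Fin 2 → ℕ
classParity zero       = 1
classParity (suc zero) = 0

-- v is numbered 2w + b for its class (w , b), so its label 2w + b + 1 has the parity of b + 1.
numberingByClasses : ∀ {a} {V W : Set a} {q m} (classes : V ↔ (W × Fin 2)) →
  W ↔ Fin q → m ≡ q * 2 →
  Σ (V ↔ Fin m) λ e → ∀ v → suc (toℕ (Inverse.to e v)) % 2 ≡ classParity (proj₂ (Inverse.to classes v))
numberingByClasses {q = q} classes numberW refl = numbering , λ v → parity-combine _ _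
  where
  numbering = ↔-trans classes (↔-trans (numberW ×-↔ ↔-refl) (↔-sym (*↔× {q} {2})))
  parity-combine : ∀ (w : Fin q) b → suc (toℕ (combine w b)) % 2 ≡ classParity b
  parity-combine w b = begin
      suc (toℕ (combine w b)) % 2    ≡⟨ cong (λ k → suc k % 2) (toℕ-combine w b) ⟩
      suc (2 * toℕ w + toℕ b) % 2    ≡⟨ cong (_% 2) (rearrange (toℕ w) (toℕ b)) ⟩
      (suc (toℕ b) + toℕ w * 2) % 2  ≡⟨ [m+kn]%n≡m%n (suc (toℕ b)) (toℕ w) 2 ⟩
      suc (toℕ b) % 2                ≡⟨ classParity-toℕ b ⟩
      classParity b                  ∎
    where
    open ≡-Reasoning
    rearrange : ∀ w b → suc (2 * w + b) ≡ suc b + w * 2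
    rearrange = solve 2 (λ w b → con 1 :+ (con 2 :* w :+ b) := con 1 :+ b :+ w :* con 2) refl
    classParity-toℕ : ∀ b → suc (toℕ b) % 2 ≡ classParity b
    classParity-toℕ zero       = refl
    classParity-toℕ (suc zero) = refl

-- For n = 2t + 1: class 0 holds the root, the last t children with all their grandchildren, and the
-- first t grandchildren of child 0; class 1 holds the first t + 1 children with their remaining
-- grandchildren. The negative edges are then the t + 1 root edges into class 1 and the t edges
-- from child 0 to its class-0 grandchildren.
module OptimalLabelling (t : ℕ) where

  private
    n : ℕ
    n = suc (t + t)

  HalfVertex : Set
  HalfVertex = Fin (suc t) ⊎ (Fin t ⊎ Fin t × Fin (t + t))

  halfVertexNumbering : HalfVertex ↔ Fin (halfOrder t)
  halfVertexNumbering =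
    ↔-sym (↔-trans (+↔⊎ {suc t})
                   (↔-refl ⊎-↔ ↔-trans (+↔⊎ {t}) (↔-refl ⊎-↔ *↔× {t} {t + t})))

  childClass : Fin (suc t) ⊎ Fin t → HalfVertex × Fin 2
  childClass (inj₁ a) = inj₁ a , suc zero
  childClass (inj₂ b) = inj₁ (suc b) , zero

  childZeroGrandchildClass : Fin t ⊎ Fin t → HalfVertex × Fin 2
  childZeroGrandchildClass (inj₁ j) = inj₂ (inj₁ j) , zero
  childZeroGrandchildClass (inj₂ j) = inj₂ (inj₁ j) , suc zero

  grandchildClass : Fin (suc t) ⊎ Fin t → Fin (t + t) → HalfVertex × Fin 2
  grandchildClass (inj₁ zero)    j = childZeroGrandchildClass (splitAt t j)
  grandchildClass (inj₁ (suc a)) j = inj₂ (inj₂ (a , j)) , suc zero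
  grandchildClass (inj₂ b)       j = inj₂ (inj₂ (b , j)) , zero

  toClass : TVertex n → HalfVertex × Fin 2
  toClass (inj₁ tt)             = inj₁ zero , zero
  toClass (inj₂ (inj₁ i))       = childClass (splitAt (suc t) i)
  toClass (inj₂ (inj₂ (i , j))) = grandchildClass (splitAt (suc t) i) j

  fromClass₀ fromClass₁ : HalfVertex → TVertex n
  fromClass₀ (inj₁ zero)           = root
  fromClass₀ (inj₁ (suc b))        = child (suc t ↑ʳ b)
  fromClass₀ (inj₂ (inj₁ j))       = grandchild zero (j ↑ˡ t)
  fromClass₀ (inj₂ (inj₂ (b , j))) = grandchild (suc t ↑ʳ b) j
  fromClass₁ (inj₁ a)              = child (a ↑ˡ t)
  fromClass₁ (inj₂ (inj₁ j))       = grandchild zero (t ↑ʳ j)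
  fromClass₁ (inj₂ (inj₂ (a , j))) = grandchild (suc a ↑ˡ t) j

  fromClass : HalfVertex × Fin 2 → TVertex n
  fromClass (w , zero)     = fromClass₀ w
  fromClass (w , suc zero) = fromClass₁ w

  toClass-fromClass : ∀ w → toClass (fromClass w) ≡ w
  toClass-fromClass (inj₁ zero , zero)                                                   = refl
  toClass-fromClass (inj₁ (suc b) , zero)          rewrite splitAt-↑ʳ (suc t) t b       = refl
  toClass-fromClass (inj₂ (inj₁ j) , zero)         rewrite splitAt-↑ˡ t j t             = refl
  toClass-fromClass (inj₂ (inj₂ (b , j)) , zero)   rewrite splitAt-↑ʳ (suc t) t b       = refl
  toClass-fromClass (inj₂ (inj₁ j) , suc zero)     rewrite splitAt-↑ʳ t t j             = refl
  toClass-fromClass (inj₂ (inj₂ (a , j)) , suc zero) rewrite splitAt-↑ˡ (suc t) (suc a) t = refl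
  toClass-fromClass (inj₁ a , suc zero) = cong childClass (splitAt-↑ˡ (suc t) a t)

  fromClass-toClass : ∀ v → fromClass (toClass v) ≡ v
  fromClass-toClass (inj₁ tt) = refl
  fromClass-toClass (inj₂ (inj₁ i)) =
    trans (fromChildClass (splitAt (suc t) i)) (cong child (join-splitAt (suc t) t i))
    where
    fromChildClass : ∀ s → fromClass (childClass s) ≡ child (join (suc t) t s)
    fromChildClass (inj₁ a) = refl
    fromChildClass (inj₂ b) = refl
  fromClass-toClass (inj₂ (inj₂ (i , j))) =
    trans (fromGrandchildClass (splitAt (suc t) i)) (cong (λ k → grandchild k j) (join-splitAt (suc t) t i))
    where
    fromChildZeroGrandchildClass : ∀ s →
      fromClass (childZeroGrandchildClass s) ≡ grandchild zero (join t t s)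
    fromChildZeroGrandchildClass (inj₁ j) = refl
    fromChildZeroGrandchildClass (inj₂ j) = refl
    fromGrandchildClass : ∀ s → fromClass (grandchildClass s j) ≡ grandchild (join (suc t) t s) j
    fromGrandchildClass (inj₁ zero)    =
      trans (fromChildZeroGrandchildClass (splitAt t j)) (cong (grandchild zero) (join-splitAt t t j))
    fromGrandchildClass (inj₁ (suc a)) = refl
    fromGrandchildClass (inj₂ b)       = refl

  classes : TVertex n ↔ (HalfVertex × Fin 2)
  classes = mk↔ₛ′ toClass fromClass toClass-fromClass fromClass-toClass

  private
    numbered = numberingByClasses classes halfVertexNumbering (order≡halfOrder*2 t)

  labelling : Labelling (perfectTree2 n)
  labelling = ↔⇒⤖ (proj₁ numbered)

  classColour : TVertex n → ℕ
  classColour v = classParity (proj₂ (toClass v))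

  childCost : Fin (suc t) ⊎ Fin t → ℕ
  childCost s = differ 1 (colour (childClass s))
              + ∑[ j < t + t ] differ (colour (childClass s)) (colour (grandchildClass s j))
    where colour = classParity ∘ proj₂

  negEdges-labelling : negEdges (perfectTree2 n) labelling ≡ n
  negEdges-labelling = begin
      negEdges (perfectTree2 n) labelling
    ≡⟨ negEdges≡∑branchCost labelling ⟩
      ∑[ i < n ] branchCost (parity labelling) i
    ≡⟨ sum-cong-≗ (branchCost-cong (proj₂ numbered)) ⟩
      ∑[ i < n ] branchCost classColour i
    ≡⟨ sum-splitAt (suc t) childCost ⟩
      childCost (inj₁ zero) + ∑[ a < t ] childCost (inj₁ (suc a)) + ∑[ b < t ] childCost (inj₂ b)
    ≡⟨ cong₂ _+_ (cong₂ _+_ childZeroCost otherClass₁Cost) class₀Cost ⟩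
      suc (t + 0) + t + 0
    ≡⟨ solve 1 (λ t → con 1 :+ (t :+ con 0) :+ t :+ con 0 := con 1 :+ (t :+ t)) refl t ⟩
      n ∎
    where
    open ≡-Reasoning
    childZeroCost : childCost (inj₁ zero) ≡ suc (t + 0)
    childZeroCost = cong suc
      (trans (sum-splitAt t (differ 0 ∘ classParity ∘ proj₂ ∘ childZeroGrandchildClass))
             (cong₂ _+_ (sum-ones t) (sum-replicate-zero t)))
    otherClass₁Cost : ∑[ a < t ] childCost (inj₁ (suc a)) ≡ t
    otherClass₁Cost = trans (sum-cong-≗ {t} λ _ → cong suc (sum-replicate-zero (t + t))) (sum-ones t)
    class₀Cost : ∑[ b < t ] childCost (inj₂ b) ≡ 0
    class₀Cost = trans (sum-cong-≗ {t} λ _ → sum-replicate-zero (t + t)) (sum-replicate-zero t)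

module _ {N : ℕ} where
  private
    n : ℕ
    n = suc N
    G = perfectTree2 n

  incident : (v : TVertex n) (e : TVertex n × TVertex n) → Dec ((proj₁ e ≡ v) ⊎ (proj₂ e ≡ v))
  incident v e = (proj₁ e ≟T v) ⊎-dec (proj₂ e ≟T v)

  branchDegree : TVertex n → Fin n → ℕ
  branchDegree v i =
    𝟙[ incident v (root , child i) ] + ∑[ j < N ] 𝟙[ incident v (child i , grandchild i j) ]

  ∑branchDegree-root : ∑[ i < n ] branchDegree root i ≤ n
  ∑branchDegree-root = begin
      ∑[ i < n ] branchDegree root i
    ≡⟨ sum-cong-≗ {n} (λ i → trans (cong (𝟙[ incident root (root , child i) ] +_)
                                         (sum-replicate-zero N))
                                   (+-identityʳ _)) ⟩
      ∑[ i < n ] 𝟙[ incident root (root , child i) ]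
    ≤⟨ sum-mono (λ i → 𝟙≤1 (incident root (root , child i))) ⟩
      ∑[ i < n ] 1
    ≡⟨ sum-ones n ⟩
      n ∎
    where open ≤-Reasoning

  ∑branchDegree-inBranch : ∀ v i₀ → (∀ {i} → (root ≡ v) ⊎ (child i ≡ v) → i ≡ i₀) →
    (∀ {i j} → (child i ≡ v) ⊎ (grandchild i j ≡ v) → i ≡ i₀) →
    ∑[ i < n ] branchDegree v i ≤ n
  ∑branchDegree-inBranch v i₀ rootEdge childEdge = begin
      ∑[ i < n ] branchDegree v i
    ≤⟨ sum-mono {n} {g = λ i → n * 𝟙[ i ≟F i₀ ]} branchDegree≤ ⟩
      ∑[ i < n ] (n * 𝟙[ i ≟F i₀ ])
    ≡⟨ *-distribˡ-sum n (λ i → 𝟙[ i ≟F i₀ ]) ⟨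
      n * ∑[ i < n ] 𝟙[ i ≟F i₀ ]
    ≡⟨ cong (n *_) (sum-𝟙-≟ i₀) ⟩
      n * 1
    ≡⟨ *-identityʳ n ⟩
      n ∎
    where
    open ≤-Reasoning
    branchDegree≤ : ∀ i → branchDegree v i ≤ n * 𝟙[ i ≟F i₀ ]
    branchDegree≤ i = +-mono-≤ (𝟙-mono rootEdge (incident v (root , child i)) (i ≟F i₀))
      (≤-trans (sum-mono λ j → 𝟙-mono childEdge (incident v (child i , grandchild i j)) (i ≟F i₀))
               (≤-reflexive (sum-const N _)))

  degree≤ : ∀ v → degree G v ≤ n
  degree≤ v = ≤-trans (≤-reflexive (length-filter-edges (incident v))) (∑branchDegree≤ v)
    where
    ∑branchDegree≤ : ∀ v → ∑[ i < n ] branchDegree v i ≤ n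
    ∑branchDegree≤ (inj₁ tt)               = ∑branchDegree-root
    ∑branchDegree≤ (inj₂ (inj₁ i₀))        =
      ∑branchDegree-inBranch (child i₀) i₀ (λ { (inj₂ refl) → refl }) (λ { (inj₁ refl) → refl })
    ∑branchDegree≤ (inj₂ (inj₂ (i₀ , j₀))) =
      ∑branchDegree-inBranch (grandchild i₀ j₀) i₀ (λ { (inj₁ ()) ; (inj₂ ()) })
                                                   (λ { (inj₂ refl) → refl })

  maxDegree≤ : maxDegree G ≤ n
  maxDegree≤ = foldr-preservesᵇ {P = _≤ n} ⊔-lub z≤n (map⁺ (universal degree≤ (Graph.vertices G)))

rnaNumber : ∀ t → IsRnaNumber (perfectTree2 (suc (t + t))) (suc (t + t))
rnaNumber t = (labelling , negEdges-labelling) , n≤negEdges t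
  where open OptimalLabelling t

⌈maxDegree/2⌉< : ∀ s → ⌈ maxDegree (perfectTree2 (suc (suc s + suc s))) /2⌉ < suc (suc s + suc s)
⌈maxDegree/2⌉< s = ≤-<-trans (⌈n/2⌉-mono maxDegree≤) (⌈n/2⌉<n (s + suc s))

odd⇒suc-double : ∀ n → n % 2 ≡ 1 → ∃[ t ] n ≡ suc (t + t)
odd⇒suc-double n odd = n / 2 , (begin
    n                     ≡⟨ m≡m%n+[m/n]*n n 2 ⟩
    n % 2 + n / 2 * 2     ≡⟨ cong (_+ n / 2 * 2) odd ⟩
    1 + n / 2 * 2         ≡⟨ solve 1 (λ h → con 1 :+ h :* con 2 := con 1 :+ (h :+ h)) refl (n / 2) ⟩
    suc (n / 2 + n / 2)   ∎)
  where open ≡-Reasoning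

mainTheorem6 : ∀ (n : ℕ) → 2 < n → n % 2 ≡ 1 →
    IsRnaNumber (perfectTree2 n) n × ⌈ maxDegree (perfectTree2 n) /2⌉ < n
mainTheorem6 n 2<n odd with odd⇒suc-double n odd
... | zero  , refl = contradiction 2<n λ { (s≤s ()) }
... | suc s , refl = rnaNumber (suc s) , ⌈maxDegree/2⌉< s
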